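{- For any permutation $\sigma\in\mathfrak S_n$, $$\sum_{i=1}^n(\sigma_i-i)^2=2\sum_{\substack{1\le i<j\le n\\ \sigma_i>\sigma_j}}(\sigma_i-\sigma_j).$$
   Context: $\sigma=\sigma_1\cdots\sigma_n$ is in one-line notation. -}

module Defs where

open import Data.Nat using (ℕ; zero; suc)
open import Data.Fin using (Fin; zero; suc; toℕ; _<_; _<?_)
open import Data.Fin.Permutation using (Permutation′; _⟨$⟩ʳ_)
open import Data.Integer using (ℤ; +_; _+_; _-_; _*_)
open import Relation.Nullary.Decidable using (Dec; yes; no)

∑ : (n : ℕ) → (Fin n → ℤ) → ℤ
∑ zero    f = + 0
∑ (suc n) f = f zero + ∑ n (λ i → f (suc i))

-- σ_i in one-line notation, with positions and values 1-based: σ_i = 1 + toℕ (σ (i-1))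
val : {n : ℕ} → Permutation′ n → Fin n → ℤ
val σ i = + suc (toℕ (σ ⟨$⟩ʳ i))

pos : {n : ℕ} → Fin n → ℤ
pos i = + suc (toℕ i)

when : {P : Set} → Dec P → ℤ → ℤ
when (yes _) x = x
when (no _)  _ = + 0

lhs : {n : ℕ} → Permutation′ n → ℤ
lhs {n} σ = ∑ n (λ i → (val σ i - pos i) * (val σ i - pos i))

invSum : {n : ℕ} → Permutation′ n → ℤ
invSum {n} σ = ∑ n (λ i → ∑ n (λ j →
  when (i <? j) (when ((σ ⟨$⟩ʳ j) <? (σ ⟨$⟩ʳ i)) (val σ i - val σ j))))

-- Write d_i = σ_i − i. Since 2·max(x, 0) = |x| + x, twice the right-hand side is
-- Σ_{i<j} |σ_i − σ_j| + Σ_{i<j} (σ_i − σ_j). The first sum is half the double sum of a symmetric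
-- function with zero diagonal, hence unchanged by relabelling through σ, so it equals Σ_{i<j} (j − i);
-- altogether twice the right-hand side is Σ_{i<j} (d_i − d_j). Position i has n − i successors and
-- i − 1 predecessors, so this is Σ_i (n + 1 − 2i) d_i, and (n + 1 − 2i) d_i = d_i² + f(i) − f(σ_i)
-- with f(k) = k² − (n + 1) k; the f-terms cancel because σ is a bijection.

module Submission where

open import Defs
open import Data.Nat as ℕ using (ℕ; zero; suc; _∸_; ∣_-_∣)
import Data.Nat.Properties as ℕ
open import Data.Fin using (Fin; zero; suc; toℕ; _<_; _<?_)
open import Data.Fin.Properties using (<-cmp)
open import Data.Fin.Permutation using (Permutation′; _⟨$⟩ʳ_)
open import Data.Integer using (ℤ; +_; _+_; _-_; _*_; -_; -1ℤ)
import Data.Integer.Properties as ℤ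
open import Data.Integer.Tactic.RingSolver using (solve-∀)
open import Function using (_∘_)
open import Relation.Binary using (tri<; tri≈; tri>)
open import Relation.Binary.PropositionalEquality
open import Relation.Nullary using (¬_; Dec; yes; no; contradiction)

open import Algebra.Properties.Semiring.Sum ℤ.+-*-semiring
  using (sum; sum-syntax; sum-cong-≗; ∑-distrib-+; ∑-comm; ∑-permute; *-distribˡ-sum)

∑≡sum : ∀ n (f : Fin n → ℤ) → ∑ n f ≡ sum f
∑≡sum zero    f = refl
∑≡sum (suc n) f = cong (_+_ (f zero)) (∑≡sum n (f ∘ suc))

sum-const : ∀ n (c : ℤ) → sum {n} (λ _ → c) ≡ + n * c
sum-const zero    c = refl
sum-const (suc n) c = trans (cong (_+_ c) (sum-const n c)) (sym (ℤ.suc-* (+ n) c))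

sum-neg : ∀ {n} (f : Fin n → ℤ) → sum (λ i → - f i) ≡ - sum f
sum-neg f = begin
  sum (λ i → - f i)       ≡⟨ sum-cong-≗ (λ i → sym (ℤ.-1*i≡-i (f i))) ⟩
  sum (λ i → -1ℤ * f i)   ≡⟨ *-distribˡ-sum -1ℤ f ⟨
  -1ℤ * sum f             ≡⟨ ℤ.-1*i≡-i (sum f) ⟩
  - sum f                 ∎
  where open ≡-Reasoning

∑-distrib-sub : ∀ {n} (f g : Fin n → ℤ) → sum (λ i → f i - g i) ≡ sum f - sum g
∑-distrib-sub f g = trans (∑-distrib-+ f (λ i → - g i)) (cong (_+_ (sum f)) (sum-neg g))

module _ {P : Set} where

  when-distrib-+ : (d : Dec P) → ∀ x y → when d (x + y) ≡ when d x + when d y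
  when-distrib-+ (yes _) x y = refl
  when-distrib-+ (no  _) x y = refl

  when-distrib-sub : (d : Dec P) → ∀ x y → when d (x - y) ≡ when d x - when d y
  when-distrib-sub (yes _) x y = refl
  when-distrib-sub (no  _) x y = refl

  *-distribˡ-when : (d : Dec P) → ∀ c x → c * when d x ≡ when d (c * x)
  *-distribˡ-when (yes _) c x = refl
  *-distribˡ-when (no  _) c x = ℤ.*-zeroʳ c

  when-cong : (d : Dec P) → ∀ {x y} → (P → x ≡ y) → when d x ≡ when d y
  when-cong (yes p) x≡y = x≡y p
  when-cong (no  _) x≡y = refl

  when-true : (d : Dec P) → ∀ {x} → P → when d x ≡ x
  when-true (yes _) p = refl
  when-true (no ¬p) p = contradiction p ¬p

  when-false : (d : Dec P) → ∀ {x} → ¬ P → when d x ≡ + 0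
  when-false (yes p) ¬p = contradiction p ¬p
  when-false (no  _) ¬p = refl

when-⇔ : ∀ {P Q : Set} (d : Dec P) (e : Dec Q) {x} → (P → Q) → (Q → P) → when d x ≡ when e x
when-⇔ (yes _) (yes _) _   _   = refl
when-⇔ (yes p) (no ¬q) p⇒q _   = contradiction (p⇒q p) ¬q
when-⇔ (no ¬p) (yes q) _   q⇒p = contradiction (q⇒p q) ¬p
when-⇔ (no _)  (no _)  _   _   = refl

when-suc<suc : ∀ {n} (i j : Fin n) x → when (suc i <? suc j) x ≡ when (i <? j) x
when-suc<suc i j x = when-⇔ (suc i <? suc j) (i <? j) ℕ.s<s⁻¹ ℕ.s<s

sum-when-below : ∀ {n} (i : Fin n) c → ∑[ j < n ] when (j <? i) c ≡ + toℕ i * c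
sum-when-below {suc n} zero    c = begin
  ∑[ j < suc n ] when (j <? zero {n}) c   ≡⟨ sum-cong-≗ {suc n} (λ j → when-false (j <? zero {n}) {c} (λ ())) ⟩
  ∑[ j < suc n ] (+ 0)                    ≡⟨ sum-const (suc n) (+ 0) ⟩
  + suc n * + 0                           ≡⟨ ℤ.*-zeroʳ (+ suc n) ⟩
  + 0                                     ∎
  where open ≡-Reasoning
sum-when-below {suc n} (suc i) c = begin
  c + ∑[ j < n ] when (suc j <? suc i) c  ≡⟨ cong (_+_ c) (sum-cong-≗ {n} (λ j → when-suc<suc j i c)) ⟩
  c + ∑[ j < n ] when (j <? i) c          ≡⟨ cong (_+_ c) (sum-when-below i c) ⟩
  c + + toℕ i * c                         ≡⟨ ℤ.suc-* (+ toℕ i) c ⟨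
  + toℕ (suc i) * c                       ∎
  where open ≡-Reasoning

sum-when-above : ∀ {n} (i : Fin n) c → ∑[ j < n ] when (i <? j) c ≡ (+ n - pos i) * c
sum-when-above {suc n} zero    c = begin
  + 0 + ∑[ j < n ] when (zero {n} <? suc j) c
    ≡⟨ cong (_+_ (+ 0)) (sum-cong-≗ {n} (λ j → when-true (zero {n} <? suc j) {c} ℕ.z<s)) ⟩
  + 0 + ∑[ j < n ] c
    ≡⟨ cong (_+_ (+ 0)) (sum-const n c) ⟩
  + 0 + + n * c
    ≡⟨ shift (+ n) c ⟩
  (+ 1 + + n - + 1) * c
    ∎
  where
  open ≡-Reasoning
  shift : ∀ m c → + 0 + m * c ≡ (+ 1 + m - + 1) * c
  shift = solve-∀
sum-when-above {suc n} (suc i) c = begin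
  + 0 + ∑[ j < n ] when (suc i <? suc j) c
    ≡⟨ cong (_+_ (+ 0)) (sum-cong-≗ {n} (λ j → when-suc<suc i j c)) ⟩
  + 0 + ∑[ j < n ] when (i <? j) c
    ≡⟨ cong (_+_ (+ 0)) (sum-when-above i c) ⟩
  + 0 + (+ n - pos i) * c
    ≡⟨ shift (+ n) (+ toℕ i) c ⟩
  (+ 1 + + n - (+ 1 + pos i)) * c
    ∎
  where
  open ≡-Reasoning
  shift : ∀ m k c → + 0 + (m - (+ 1 + k)) * c ≡ (+ 1 + m - (+ 1 + (+ 1 + k))) * c
  shift = solve-∀

∑ᵢ<ⱼ : ∀ {n} → (Fin n → Fin n → ℤ) → ℤ
∑ᵢ<ⱼ {n} F = ∑[ i < n ] ∑[ j < n ] when (i <? j) (F i j)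

module _ {n : ℕ} where

  ∑ᵢ<ⱼ-cong : {F G : Fin n → Fin n → ℤ} → (∀ {i j} → i < j → F i j ≡ G i j) → ∑ᵢ<ⱼ F ≡ ∑ᵢ<ⱼ G
  ∑ᵢ<ⱼ-cong F≡G = sum-cong-≗ {n} λ i → sum-cong-≗ {n} λ j → when-cong (i <? j) F≡G

  ∑ᵢ<ⱼ-distrib-+ : (F G : Fin n → Fin n → ℤ) → ∑ᵢ<ⱼ (λ i j → F i j + G i j) ≡ ∑ᵢ<ⱼ F + ∑ᵢ<ⱼ G
  ∑ᵢ<ⱼ-distrib-+ F G = trans
    (sum-cong-≗ {n} λ i → trans (sum-cong-≗ {n} λ j → when-distrib-+ (i <? j) (F i j) (G i j)) (∑-distrib-+ {n} _ _))
    (∑-distrib-+ {n} _ _)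

  *-distribˡ-∑ᵢ<ⱼ : ∀ c (F : Fin n → Fin n → ℤ) → c * ∑ᵢ<ⱼ F ≡ ∑ᵢ<ⱼ (λ i j → c * F i j)
  *-distribˡ-∑ᵢ<ⱼ c F = trans (*-distribˡ-sum {n} c _)
    (sum-cong-≗ {n} λ i → trans (*-distribˡ-sum {n} c _) (sum-cong-≗ {n} λ j → *-distribˡ-when (i <? j) c (F i j)))

  split-at-diagonal : (F : Fin n → Fin n → ℤ) → (∀ i → F i i ≡ + 0) →
    ∀ i j → F i j ≡ when (i <? j) (F i j) + when (j <? i) (F i j)
  split-at-diagonal F F-diag i j with <-cmp i j
  ... | tri< i<j _ j≮i = sym (trans (cong₂ _+_ (when-true (i <? j) i<j) (when-false (j <? i) j≮i)) (ℤ.+-identityʳ _))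
  ... | tri≈ i≮j refl _ = trans (F-diag i) (sym (cong₂ _+_ (when-false (i <? i) i≮j) (when-false (i <? i) i≮j)))
  ... | tri> i≮j _ j<i = sym (trans (cong₂ _+_ (when-false (i <? j) i≮j) (when-true (j <? i) j<i)) (ℤ.+-identityˡ _))

  ∑∑≡2*∑ᵢ<ⱼ : (F : Fin n → Fin n → ℤ) → (∀ i j → F i j ≡ F j i) → (∀ i → F i i ≡ + 0) →
    ∑[ i < n ] ∑[ j < n ] F i j ≡ + 2 * ∑ᵢ<ⱼ F
  ∑∑≡2*∑ᵢ<ⱼ F F-sym F-diag = begin
    ∑[ i < n ] ∑[ j < n ] F i j
      ≡⟨ sum-cong-≗ {n} (λ i → sum-cong-≗ {n} (split-at-diagonal F F-diag i)) ⟩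
    ∑[ i < n ] ∑[ j < n ] (when (i <? j) (F i j) + when (j <? i) (F i j))
      ≡⟨ trans (sum-cong-≗ {n} λ i → ∑-distrib-+ {n} _ _) (∑-distrib-+ {n} _ _) ⟩
    ∑ᵢ<ⱼ F + ∑[ i < n ] ∑[ j < n ] when (j <? i) (F i j)
      ≡⟨ cong (_+_ (∑ᵢ<ⱼ F)) (∑-comm {n} {n} _) ⟩
    ∑ᵢ<ⱼ F + ∑ᵢ<ⱼ (λ i j → F j i)
      ≡⟨ cong (_+_ (∑ᵢ<ⱼ F)) (∑ᵢ<ⱼ-cong (λ {i} {j} _ → F-sym j i)) ⟩
    ∑ᵢ<ⱼ F + ∑ᵢ<ⱼ F
      ≡⟨ double (∑ᵢ<ⱼ F) ⟩
    + 2 * ∑ᵢ<ⱼ F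
      ∎
    where
    open ≡-Reasoning
    double : ∀ x → x + x ≡ + 2 * x
    double = solve-∀

  ∑ᵢ<ⱼ-permute : (σ : Permutation′ n) (F : Fin n → Fin n → ℤ) →
    (∀ i j → F i j ≡ F j i) → (∀ i → F i i ≡ + 0) →
    ∑ᵢ<ⱼ (λ i j → F (σ ⟨$⟩ʳ i) (σ ⟨$⟩ʳ j)) ≡ ∑ᵢ<ⱼ F
  ∑ᵢ<ⱼ-permute σ F F-sym F-diag = ℤ.*-cancelˡ-≡ (+ 2) _ _ (begin
    + 2 * ∑ᵢ<ⱼ (λ i j → F (σ ⟨$⟩ʳ i) (σ ⟨$⟩ʳ j))
      ≡⟨ ∑∑≡2*∑ᵢ<ⱼ _ (λ i j → F-sym (σ ⟨$⟩ʳ i) (σ ⟨$⟩ʳ j)) (λ i → F-diag (σ ⟨$⟩ʳ i)) ⟨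
    ∑[ i < n ] ∑[ j < n ] F (σ ⟨$⟩ʳ i) (σ ⟨$⟩ʳ j)
      ≡⟨ sum-cong-≗ {n} (λ i → ∑-permute (F (σ ⟨$⟩ʳ i)) σ) ⟨
    ∑[ i < n ] ∑[ j < n ] F (σ ⟨$⟩ʳ i) j
      ≡⟨ ∑-permute (λ i → ∑[ j < n ] F i j) σ ⟨
    ∑[ i < n ] ∑[ j < n ] F i j
      ≡⟨ ∑∑≡2*∑ᵢ<ⱼ F F-sym F-diag ⟩
    + 2 * ∑ᵢ<ⱼ F
      ∎)
    where open ≡-Reasoning

  ∑ᵢ<ⱼ-sub : (x : Fin n → ℤ) → ∑ᵢ<ⱼ (λ i j → x i - x j) ≡ ∑[ i < n ] ((+ n - pos i - + toℕ i) * x i)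
  ∑ᵢ<ⱼ-sub x = begin
    ∑ᵢ<ⱼ (λ i j → x i - x j)
      ≡⟨ sum-cong-≗ {n} (λ i → trans (sum-cong-≗ {n} λ j → when-distrib-sub (i <? j) (x i) (x j)) (∑-distrib-sub {n} _ _)) ⟩
    ∑[ i < n ] (∑[ j < n ] when (i <? j) (x i) - ∑[ j < n ] when (i <? j) (x j))
      ≡⟨ ∑-distrib-sub {n} _ _ ⟩
    ∑[ i < n ] ∑[ j < n ] when (i <? j) (x i) - ∑[ i < n ] ∑[ j < n ] when (i <? j) (x j)
      ≡⟨ cong₂ _-_ (sum-cong-≗ {n} λ i → sum-when-above i (x i))
                   (trans (∑-comm {n} {n} _) (sum-cong-≗ {n} λ j → sum-when-below j (x j))) ⟩
    ∑[ i < n ] ((+ n - pos i) * x i) - ∑[ i < n ] (+ toℕ i * x i)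
      ≡⟨ ∑-distrib-sub {n} _ _ ⟨
    ∑[ i < n ] ((+ n - pos i) * x i - + toℕ i * x i)
      ≡⟨ sum-cong-≗ {n} (λ i → sym (*-distribʳ-sub (+ n - pos i) (+ toℕ i) (x i))) ⟩
    ∑[ i < n ] ((+ n - pos i - + toℕ i) * x i)
      ∎
    where
    open ≡-Reasoning
    *-distribʳ-sub : ∀ a b c → (a - b) * c ≡ a * c - b * c
    *-distribʳ-sub = solve-∀

+[m∸n]≡+m-+n : ∀ {m n} → n ℕ.≤ m → + (m ∸ n) ≡ + m - + n
+[m∸n]≡+m-+n {m} {n} n≤m = sym (trans (ℤ.m-n≡m⊖n m n) (ℤ.⊖-≥ n≤m))

twice-positive-part : ∀ a b → + 2 * when (b ℕ.<? a) (+ a - + b) ≡ + ∣ a - b ∣ + (+ a - + b)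
twice-positive-part a b with b ℕ.<? a
... | yes b<a = begin
  + 2 * (+ a - + b)             ≡⟨ double (+ a - + b) ⟩
  (+ a - + b) + (+ a - + b)     ≡⟨ cong (_+ (+ a - + b)) (+[m∸n]≡+m-+n (ℕ.<⇒≤ b<a)) ⟨
  + (a ∸ b) + (+ a - + b)       ≡⟨ cong (λ k → + k + (+ a - + b)) (ℕ.m≤n⇒∣n-m∣≡n∸m (ℕ.<⇒≤ b<a)) ⟨
  + ∣ a - b ∣ + (+ a - + b)     ∎
  where
  open ≡-Reasoning
  double : ∀ x → + 2 * x ≡ x + x
  double = solve-∀
... | no b≮a = begin
  + 0                           ≡⟨ cancel (+ a) (+ b) ⟩
  (+ b - + a) + (+ a - + b)     ≡⟨ cong (_+ (+ a - + b)) (+[m∸n]≡+m-+n (ℕ.≮⇒≥ b≮a)) ⟨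
  + (b ∸ a) + (+ a - + b)       ≡⟨ cong (λ k → + k + (+ a - + b)) (ℕ.m≤n⇒∣m-n∣≡n∸m (ℕ.≮⇒≥ b≮a)) ⟨
  + ∣ a - b ∣ + (+ a - + b)     ∎
  where
  open ≡-Reasoning
  cancel : ∀ x y → + 0 ≡ (y - x) + (x - y)
  cancel = solve-∀

distance : ∀ {n} → Fin n → Fin n → ℤ
distance a b = + ∣ toℕ a - toℕ b ∣

distance-sym : ∀ {n} (a b : Fin n) → distance a b ≡ distance b a
distance-sym a b = cong +_ (ℕ.∣-∣-comm (toℕ a) (toℕ b))

distance-diag : ∀ {n} (a : Fin n) → distance a a ≡ + 0
distance-diag a = cong +_ (ℕ.∣n-n∣≡0 (toℕ a))

distance-< : ∀ {n} {a b : Fin n} → a < b → distance a b ≡ + toℕ b - + toℕ a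
distance-< a<b = trans (cong +_ (ℕ.m≤n⇒∣m-n∣≡n∸m (ℕ.<⇒≤ a<b))) (+[m∸n]≡+m-+n (ℕ.<⇒≤ a<b))

module _ {n : ℕ} (σ : Permutation′ n) where

  displacement : Fin n → ℤ
  displacement i = + toℕ (σ ⟨$⟩ʳ i) - + toℕ i

  ∑displacement²≡∑weighted-displacement :
    ∑[ i < n ] (displacement i * displacement i) ≡ ∑[ i < n ] ((+ n - pos i - + toℕ i) * displacement i)
  ∑displacement²≡∑weighted-displacement = begin
    ∑[ i < n ] (d i * d i)
      ≡⟨ ℤ.+-identityʳ _ ⟨
    ∑[ i < n ] (d i * d i) + + 0
      ≡⟨ cong (_+_ (∑[ i < n ] (d i * d i))) (ℤ.+-inverseʳ (∑[ i < n ] f (p i))) ⟨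
    ∑[ i < n ] (d i * d i) + (∑[ i < n ] f (p i) - ∑[ i < n ] f (p i))
      ≡⟨ cong (λ t → ∑[ i < n ] (d i * d i) + (∑[ i < n ] f (p i) - t)) (∑-permute (f ∘ p) σ) ⟩
    ∑[ i < n ] (d i * d i) + (∑[ i < n ] f (p i) - ∑[ i < n ] f (s i))
      ≡⟨ trans (∑-distrib-+ {n} _ _) (cong (_+_ (∑[ i < n ] (d i * d i))) (∑-distrib-sub {n} _ _)) ⟨
    ∑[ i < n ] (d i * d i + (f (p i) - f (s i)))
      ≡⟨ sum-cong-≗ {n} (λ i → pointwise (+ n) (s i) (p i)) ⟩
    ∑[ i < n ] ((+ n - pos i - + toℕ i) * d i)
      ∎
    where
    open ≡-Reasoning
    d p s : Fin n → ℤ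
    d = displacement
    p i = + toℕ i
    s i = + toℕ (σ ⟨$⟩ʳ i)
    f : ℤ → ℤ
    f k = k * k - (+ n - + 1) * k
    pointwise : ∀ m x y → (x - y) * (x - y) + ((y * y - (m - + 1) * y) - (x * x - (m - + 1) * x))
                        ≡ (m - (+ 1 + y) - y) * (x - y)
    pointwise = solve-∀

lemma3p3 : (n : ℕ) (σ : Permutation′ n) →
    lhs σ ≡ + 2 * invSum σ
lemma3p3 n σ = begin
  lhs σ
    ≡⟨ lhs≡∑d² ⟩
  ∑[ i < n ] (d i * d i)
    ≡⟨ ∑displacement²≡∑weighted-displacement σ ⟩
  ∑[ i < n ] ((+ n - pos i - + toℕ i) * d i)
    ≡⟨ ∑ᵢ<ⱼ-sub d ⟨
  ∑ᵢ<ⱼ (λ i j → d i - d j)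
    ≡⟨ ∑ᵢ<ⱼ-cong {n} (λ {i} {j} i<j → regroup (distance-< i<j)) ⟩
  ∑ᵢ<ⱼ (λ i j → distance i j + (s i - s j))
    ≡⟨ ∑ᵢ<ⱼ-distrib-+ {n} distance (λ i j → s i - s j) ⟩
  ∑ᵢ<ⱼ (distance {n}) + ∑ᵢ<ⱼ (λ i j → s i - s j)
    ≡⟨ cong (_+ ∑ᵢ<ⱼ {n} (λ i j → s i - s j)) (∑ᵢ<ⱼ-permute σ distance distance-sym distance-diag) ⟨
  ∑ᵢ<ⱼ (λ i j → distance (σ ⟨$⟩ʳ i) (σ ⟨$⟩ʳ j)) + ∑ᵢ<ⱼ (λ i j → s i - s j)
    ≡⟨ ∑ᵢ<ⱼ-distrib-+ {n} (λ i j → distance (σ ⟨$⟩ʳ i) (σ ⟨$⟩ʳ j)) (λ i j → s i - s j) ⟨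
  ∑ᵢ<ⱼ (λ i j → distance (σ ⟨$⟩ʳ i) (σ ⟨$⟩ʳ j) + (s i - s j))
    ≡⟨ ∑ᵢ<ⱼ-cong {n} (λ {i} {j} _ → twice-positive-part (toℕ (σ ⟨$⟩ʳ i)) (toℕ (σ ⟨$⟩ʳ j))) ⟨
  ∑ᵢ<ⱼ (λ i j → + 2 * inversion i j)
    ≡⟨ *-distribˡ-∑ᵢ<ⱼ {n} (+ 2) inversion ⟨
  + 2 * ∑ᵢ<ⱼ inversion
    ≡⟨ cong (_*_ (+ 2)) invSum≡∑inversion ⟨
  + 2 * invSum σ
    ∎
  where
  open ≡-Reasoning
  d s : Fin n → ℤ
  d = displacement σ
  s i = + toℕ (σ ⟨$⟩ʳ i)

  -- Fin's _<?_ unfolds to ℕ's _<?_ on toℕ, which is how twice-positive-part applies to it.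
  inversion : Fin n → Fin n → ℤ
  inversion i j = when (σ ⟨$⟩ʳ j <? σ ⟨$⟩ʳ i) (s i - s j)

  one-based : ∀ x y → + 1 + x - (+ 1 + y) ≡ x - y
  one-based = solve-∀

  lhs≡∑d² : lhs σ ≡ ∑[ i < n ] (d i * d i)
  lhs≡∑d² = trans (∑≡sum n _) (sum-cong-≗ {n} λ i →
    cong₂ _*_ (one-based (s i) (+ toℕ i)) (one-based (s i) (+ toℕ i)))

  invSum≡∑inversion : invSum σ ≡ ∑ᵢ<ⱼ inversion
  invSum≡∑inversion = trans (∑≡sum n _) (sum-cong-≗ {n} λ i → trans (∑≡sum n _) (sum-cong-≗ {n} λ j →
    when-cong (i <? j) λ _ → when-cong (σ ⟨$⟩ʳ j <? σ ⟨$⟩ʳ i) λ _ → one-based (s i) (s j)))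

  regroup : ∀ {i j} → distance i j ≡ + toℕ j - + toℕ i → d i - d j ≡ distance i j + (s i - s j)
  regroup {i} {j} eq = trans (rearrange (s i) (s j) (+ toℕ i) (+ toℕ j)) (cong (_+ (s i - s j)) (sym eq))
    where
    rearrange : ∀ x y a b → (x - a) - (y - b) ≡ (b - a) + (x - y)
    rearrange = solve-∀
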